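{- Let $G$ be a connected finite simple graph. If there exists an independent set of vertices $V_c\subseteq V_G$ which separates $G$ (i.e., the subgraph of $G$ induced by $V_G\setminus V_c$ is disconnected), then $G$ has a NAC-coloring.
   Context: A coloring $\delta\colon E_G\to\{\text{blue},\text{red}\}$ is a NAC-coloring if it is surjective and $G$ contains no cycle with exactly one blue edge and no cycle with exactly one red edge. A set of vertices is independent if no two of its vertices are adjacent. -}

module Defs where

open import Data.Nat using (ℕ; _≤_)
open import Data.Fin using (Fin)
open import Data.Fin.Subset using (Subset; _∈_; _∉_)
open import Data.List using (List; []; _∷_; _++_; [_]; length; filter)
open import Data.List.Relation.Unary.All using (All)
open import Data.List.Relation.Unary.Unique.Propositional using (Unique)
open import Data.Product using (_×_; _,_; ∃; ∃-syntax; Σ-syntax)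
open import Data.Empty using (⊥)
open import Data.Unit using (⊤)
open import Relation.Nullary using (¬_; Dec; yes; no)
open import Relation.Binary using (Decidable)
open import Relation.Binary.PropositionalEquality using (_≡_; refl)

record Graph (n : ℕ) : Set₁ where
  field
    Adj    : Fin n → Fin n → Set
    sym    : ∀ {u v} → Adj u v → Adj v u
    irrefl : ∀ {u} → ¬ Adj u u
    dec    : Decidable Adj

open Graph public

data WalkIn {n : ℕ} (G : Graph n) (S : Fin n → Set) : Fin n → Fin n → Set where
  here : ∀ {u} → S u → WalkIn G S u u
  step : ∀ {u v w} → S u → Adj G u v → WalkIn G S v w → WalkIn G S u w

Connected : {n : ℕ} → Graph n → Set
Connected {n} G = Fin n × (∀ u v → WalkIn G (λ _ → ⊤) u v)

Independent : {n : ℕ} → Graph n → Subset n → Set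
Independent G Vc = ∀ u v → u ∈ Vc → v ∈ Vc → ¬ Adj G u v

Separates : {n : ℕ} → Graph n → Subset n → Set
Separates G Vc =
  ∃[ u ] ∃[ v ] (u ∉ Vc × v ∉ Vc × ¬ WalkIn G (λ x → x ∉ Vc) u v)

data Color : Set where
  blue red : Color

_≟c_ : Decidable {A = Color} _≡_
blue ≟c blue = yes refl
blue ≟c red  = no (λ ())
red  ≟c blue = no (λ ())
red  ≟c red  = yes refl

-- An edge coloring is represented by a function on ordered vertex pairs
-- which is symmetric on edges (its values on non-edges are irrelevant).
record EdgeColoring {n : ℕ} (G : Graph n) : Set where
  field
    col     : Fin n → Fin n → Color
    col-sym : ∀ u v → Adj G u v → col u v ≡ col v u

open EdgeColoring public

consecutive : {A : Set} → List A → List (A × A)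
consecutive []           = []
consecutive (x ∷ [])     = []
consecutive (x ∷ y ∷ xs) = (x , y) ∷ consecutive (y ∷ xs)

cycleEdges : {A : Set} → List A → List (A × A)
cycleEdges []       = []
cycleEdges (x ∷ xs) = consecutive (x ∷ xs ++ [ x ])

IsCycle : {n : ℕ} → Graph n → List (Fin n) → Set
IsCycle G vs = 3 ≤ length vs × Unique vs × All (λ e → Adj G (Data.Product.proj₁ e) (Data.Product.proj₂ e)) (cycleEdges vs)
  where import Data.Product

countColor : {n : ℕ} {G : Graph n} → EdgeColoring G → Color → List (Fin n) → ℕ
countColor δ c vs = length (filter (λ e → col δ (Data.Product.proj₁ e) (Data.Product.proj₂ e) ≟c c) (cycleEdges vs))
  where import Data.Product

IsNACColoring : {n : ℕ} (G : Graph n) → EdgeColoring G → Set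
IsNACColoring G δ =
  (∃[ u ] ∃[ v ] (Adj G u v × col δ u v ≡ blue)) ×
  (∃[ u ] ∃[ v ] (Adj G u v × col δ u v ≡ red)) ×
  (∀ vs → IsCycle G vs → ¬ countColor δ blue vs ≡ 1) ×
  (∀ vs → IsCycle G vs → ¬ countColor δ red vs ≡ 1)

HasNACColoring : {n : ℕ} → Graph n → Set
HasNACColoring G = ∃[ δ ] IsNACColoring G δ

-- Let Vc be independent and let o, r be vertices outside Vc that are not
-- joined by a walk avoiding Vc.  Take C to be the component of r in G - Vc
-- and colour an edge red when it is incident to C, blue otherwise.
--  * No cycle has exactly one red edge, whatever C is: a red edge bc has an
--    endpoint in C, so one of the two cycle edges next to it is red as well.
--  * No cycle has exactly one blue edge: if bc is blue and its neighbours ab,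
--    cd on the cycle are red, then a, d ∈ C while b, c ∉ C.  As C is closed
--    under edges into V ∖ Vc, this forces b, c ∈ Vc, contradicting that Vc
--    is independent.
--  * Both colours occur: o ∉ C, and by connectivity o and r both have
--    neighbours; an edge at r is red, an edge at o is blue.
module Submission where

open import Data.Nat using (ℕ)
open import Data.Fin.Subset using (Subset)
open import Data.Product using (∃-syntax; _×_)
open import Defs

open import Data.Nat using (zero; suc; _≤_; _≤?_; z≤n; s≤s)
open import Data.Nat.Properties using (≤-trans; ≰⇒>; 1+n≰n; <⇒≢; suc-injective)
open import Data.Fin using (Fin)
open import Data.Fin.Properties using (any?)
open import Data.Fin.Subset using (⁅_⁆; ∣_∣; _⊂_) renaming (_∈_ to _∈ₛ_; _∉_ to _∉ₛ_)
open import Data.Fin.Subset.Properties using (_∈?_; x∈⁅x⁆; x∈⁅y⁆⇒x≡y; ∣p∣≤n; p⊂q⇒∣p∣<∣q∣)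
open import Data.Vec using (tabulate)
open import Data.Vec.Properties using (lookup∘tabulate; lookup⇒[]=; []=⇒lookup)
open import Data.List using (List; []; _∷_; _++_; [_]; length; filter)
open import Data.List.Properties using (filter-some)
open import Data.List.Membership.Propositional using (_∈_; lose)
open import Data.List.Relation.Unary.Any using (here; there)
open import Data.List.Relation.Unary.All using (lookup)
open import Data.Product using (_,_; ∃; proj₁; proj₂)
open import Data.Sum using (_⊎_; inj₁; inj₂)
open import Data.Empty using (⊥-elim)
open import Relation.Nullary using (¬_; Dec; yes; no; does)
open import Relation.Nullary.Decidable using (_×-dec_; _⊎-dec_; ¬?; dec-true)
open import Relation.Unary using (Decidable)
open import Relation.Binary.PropositionalEquality using (_≡_; refl; trans) renaming (sym to ≡-sym)

module SingleMarkedEdge {A : Set} {P : A × A → Set} (P? : Decidable P) where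

  count : List (A × A) → ℕ
  count es = length (filter P? es)

  count-zero : ∀ es {e} → count es ≡ 0 → e ∈ es → ¬ P e
  count-zero es none e∈es pe = <⇒≢ (filter-some P? (lose e∈es pe)) (≡-sym none)

  Flanked : List (A × A) → Set
  Flanked es = ∃ λ a → ∃ λ b → ∃ λ c → ∃ λ d →
    ((a , b) ∈ es) × ((b , c) ∈ es) × ((c , d) ∈ es) ×
    ¬ P (a , b) × P (b , c) × ¬ P (c , d)

  firstEdge : ∀ (c : A) l x → ∃ λ d → (c , d) ∈ consecutive (c ∷ l ++ [ x ])
  firstEdge c []      x = x , here refl
  firstEdge c (d ∷ l) x = d , here refl

  lastEdge : ∀ (y : A) l x → ∃ λ w → (w , x) ∈ consecutive (y ∷ l ++ [ x ])
  lastEdge y []      x = y , here refl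
  lastEdge y (z ∷ l) x with lastEdge z l x
  ... | w , w∈ = w , there w∈

  flankedOrLast : ∀ (a b : A) l x → ¬ P (a , b) → count (consecutive (b ∷ l ++ [ x ])) ≡ 1 →
    let es = consecutive (a ∷ b ∷ l ++ [ x ]) in
    Flanked es ⊎ (∃ λ v → ∃ λ w → ((v , w) ∈ es) × ((w , x) ∈ es) × ¬ P (v , w) × P (w , x))
  flankedOrLast a b [] x ¬ab one with P? (b , x)
  ... | yes bx = inj₂ (a , b , here refl , there (here refl) , ¬ab , bx)
  flankedOrLast a b [] x ¬ab () | no _
  flankedOrLast a b (c ∷ l) x ¬ab one with P? (b , c)
  ... | yes bc with firstEdge c l x
  ...   | d , cd∈ = inj₁ (a , b , c , d , here refl , there (here refl) , there (there cd∈) ,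
                          ¬ab , bc , count-zero _ (suc-injective one) cd∈)
  flankedOrLast a b (c ∷ l) x ¬ab one | no ¬bc with flankedOrLast b c l x ¬bc one
  ... | inj₁ (a' , b' , c' , d' , ab∈ , bc∈ , cd∈ , marks) =
          inj₁ (a' , b' , c' , d' , there ab∈ , there bc∈ , there cd∈ , marks)
  ... | inj₂ (v , w , vw∈ , wx∈ , marks) = inj₂ (v , w , there vw∈ , there wx∈ , marks)

  singleMarkedFlanked : ∀ vs → 3 ≤ length vs → count (cycleEdges vs) ≡ 1 → Flanked (cycleEdges vs)
  singleMarkedFlanked (_ ∷ []) (s≤s ()) _
  singleMarkedFlanked (_ ∷ _ ∷ []) (s≤s (s≤s ())) _
  singleMarkedFlanked (x ∷ y ∷ z ∷ zs) _ one with P? (x , y)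
  ... | yes xy with lastEdge y (z ∷ zs) x
  ...   | w , wx∈ = w , x , y , z , there wx∈ , here refl , there (here refl) ,
                    count-zero _ (suc-injective one) wx∈ , xy , count-zero _ (suc-injective one) (here refl)
  singleMarkedFlanked (x ∷ y ∷ z ∷ zs) _ one | no ¬xy with flankedOrLast x y (z ∷ zs) x ¬xy one
  ... | inj₁ flanked = flanked
  ... | inj₂ (v , w , vw∈ , wx∈ , ¬vw , wx) = v , w , x , y , vw∈ , wx∈ , here refl , ¬vw , wx , ¬xy

subsetOf : ∀ {n} {S : Fin n → Set} → Decidable S → Subset n
subsetOf S? = tabulate (λ x → does (S? x))

∈-subsetOf⁺ : ∀ {n} {S : Fin n → Set} (S? : Decidable S) {x} → S x → x ∈ₛ subsetOf S?
∈-subsetOf⁺ S? {x} sx = lookup⇒[]= x _ (trans (lookup∘tabulate _ x) (dec-true (S? x) sx))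

∈-subsetOf⁻ : ∀ {n} {S : Fin n → Set} (S? : Decidable S) {x} → x ∈ₛ subsetOf S? → S x
∈-subsetOf⁻ S? {x} x∈ with S? x | trans (≡-sym (lookup∘tabulate _ x)) ([]=⇒lookup x∈)
... | yes sx | _ = sx
... | no _   | ()

stallsOrGrows : (f : ℕ → ℕ) → ∀ m → (∃ λ k → f (suc k) ≤ f k) ⊎ (m ≤ f m)
stallsOrGrows f zero = inj₂ z≤n
stallsOrGrows f (suc m) with stallsOrGrows f m
... | inj₁ stall = inj₁ stall
... | inj₂ m≤fm with f (suc m) ≤? f m
...   | yes stall = inj₁ (m , stall)
...   | no rises  = inj₂ (≤-trans (s≤s m≤fm) (≰⇒> rises))

boundedStalls : (f : ℕ → ℕ) (n : ℕ) → (∀ k → f k ≤ n) → ∃ λ k → f (suc k) ≤ f k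
boundedStalls f n bound with stallsOrGrows f (suc n)
... | inj₁ stall = stall
... | inj₂ big   = ⊥-elim (1+n≰n (≤-trans big (bound (suc n))))

-- A vertex set containing r, reachable from r inside S, and closed under
-- edges leading into S: the component of r in the subgraph induced by S.
record ClosedComponent {n : ℕ} (G : Graph n) (S : Fin n → Set) (r : Fin n) : Set where
  field
    C          : Subset n
    root       : r ∈ₛ C
    walkToRoot : ∀ {x} → x ∈ₛ C → WalkIn G S x r
    closed     : ∀ {x y} → y ∈ₛ C → Adj G y x → S x → x ∈ₛ C

-- Every vertex of a decidable vertex set S has a closed component, obtained by
-- saturating {r} under edges into S until the cardinality stops growing.
component : ∀ {n} (G : Graph n) (S : Fin n → Set) → Decidable S → ∀ r → S r → ClosedComponent G S r
component {n} G S S? r sr = record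
  { C = saturated ; root = reached K ; walkToRoot = sound K ; closed = closedSaturated }
  where
    Extends : Subset n → Fin n → Set
    Extends R x = x ∈ₛ R ⊎ (S x × ∃ λ y → y ∈ₛ R × Adj G y x)

    extends? : ∀ R → Decidable (Extends R)
    extends? R x = (x ∈? R) ⊎-dec (S? x ×-dec any? (λ y → (y ∈? R) ×-dec dec G y x))

    -- the vertices joined to r by a walk inside S of length at most k
    ball : ℕ → Subset n
    ball zero    = ⁅ r ⁆
    ball (suc k) = subsetOf (extends? (ball k))

    grow : ∀ k {x} → x ∈ₛ ball k → x ∈ₛ ball (suc k)
    grow k x∈ = ∈-subsetOf⁺ (extends? (ball k)) (inj₁ x∈)

    reached : ∀ k → r ∈ₛ ball k
    reached zero    = x∈⁅x⁆ r
    reached (suc k) = grow k (reached k)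

    sound : ∀ k {x} → x ∈ₛ ball k → WalkIn G S x r
    sound zero x∈ with x∈⁅y⁆⇒x≡y r x∈
    ... | refl = here sr
    sound (suc k) x∈ with ∈-subsetOf⁻ (extends? (ball k)) x∈
    ... | inj₁ x∈ball              = sound k x∈ball
    ... | inj₂ (sx , y , y∈ , yx) = step sx (Graph.sym G yx) (sound k y∈)

    stall : ∃ λ k → ∣ ball (suc k) ∣ ≤ ∣ ball k ∣
    stall = boundedStalls (λ k → ∣ ball k ∣) n (λ k → ∣p∣≤n (ball k))

    K : ℕ
    K = proj₁ stall

    saturated : Subset n
    saturated = ball K

    stable : ∀ {x} → x ∈ₛ ball (suc K) → x ∈ₛ saturated
    stable {x} x∈ with x ∈? saturated
    ... | yes x∈sat = x∈sat
    ... | no x∉sat  = ⊥-elim (1+n≰n (≤-trans (p⊂q⇒∣p∣<∣q∣ proper) (proj₂ stall)))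
      where
        proper : ball K ⊂ ball (suc K)
        proper = grow K , x , x∈ , x∉sat

    closedSaturated : ∀ {x y} → y ∈ₛ saturated → Adj G y x → S x → x ∈ₛ saturated
    closedSaturated y∈ yx sx = stable (∈-subsetOf⁺ (extends? saturated) (inj₂ (sx , _ , y∈ , yx)))

neighbour : ∀ {n} {G : Graph n} {S : Fin n → Set} {u v} → WalkIn G S u v → ¬ u ≡ v → ∃ λ w → Adj G u w
neighbour (here _)              u≢v = ⊥-elim (u≢v refl)
neighbour (step {v = w} _ uw _) _ = w , uw

module Incidence {n : ℕ} (G : Graph n) (C : Subset n) where

  Touches : Fin n → Fin n → Set
  Touches a b = a ∈ₛ C ⊎ b ∈ₛ C

  touches? : ∀ a b → Dec (Touches a b)
  touches? a b = (a ∈? C) ⊎-dec (b ∈? C)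

  colourBy : {A : Set} → Dec A → Color
  colourBy (yes _) = red
  colourBy (no _)  = blue

  colour : Fin n → Fin n → Color
  colour a b = colourBy (touches? a b)

  colour-sym : ∀ a b → colour a b ≡ colour b a
  colour-sym a b with a ∈? C | b ∈? C
  ... | yes _ | yes _ = refl
  ... | yes _ | no _  = refl
  ... | no _  | yes _ = refl
  ... | no _  | no _  = refl

  δ : EdgeColoring G
  δ = record { col = colour ; col-sym = λ a b _ → colour-sym a b }

  red⇒touches : ∀ a b → colour a b ≡ red → Touches a b
  red⇒touches a b _  with touches? a b
  red⇒touches a b _  | yes t = t
  red⇒touches a b () | no _

  touches⇒red : ∀ a b → Touches a b → colour a b ≡ red
  touches⇒red a b t with touches? a b
  ... | yes _ = refl
  ... | no ¬t = ⊥-elim (¬t t)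

  blue⇒apart : ∀ a b → colour a b ≡ blue → ¬ Touches a b
  blue⇒apart a b _  with touches? a b
  blue⇒apart a b () | yes _
  blue⇒apart a b _  | no ¬t = ¬t

  apart⇒blue : ∀ a b → ¬ Touches a b → colour a b ≡ blue
  apart⇒blue a b ¬t with touches? a b
  ... | yes t = ⊥-elim (¬t t)
  ... | no _  = refl

  ¬blue⇒touches : ∀ a b → ¬ colour a b ≡ blue → Touches a b
  ¬blue⇒touches a b notBlue with touches? a b
  ... | yes t = t
  ... | no _  = ⊥-elim (notBlue refl)

  -- Whatever C is, no cycle has exactly one red edge: a red edge touches C
  -- in an endpoint, which it shares with a neighbouring edge of the cycle.
  noSingleRed : ∀ vs → IsCycle G vs → ¬ countColor δ red vs ≡ 1
  noSingleRed vs (long , _ , _) one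
    with SingleMarkedEdge.singleMarkedFlanked (λ e → colour (proj₁ e) (proj₂ e) ≟c red) vs long one
  ... | a , b , c , d , _ , _ , _ , ¬ab , bc , ¬cd with red⇒touches b c bc
  ...   | inj₁ b∈C = ¬ab (touches⇒red a b (inj₂ b∈C))
  ...   | inj₂ c∈C = ¬cd (touches⇒red c d (inj₁ c∈C))

  -- If C is closed under edges leaving an independent set Vc, no cycle has
  -- exactly one blue edge bc: its red neighbours put a, d in C, closure then
  -- puts b, c in Vc, but b and c are adjacent.
  noSingleBlue : (Vc : Subset n) → Independent G Vc →
    (∀ {x y} → y ∈ₛ C → Adj G y x → x ∉ₛ Vc → x ∈ₛ C) →
    ∀ vs → IsCycle G vs → ¬ countColor δ blue vs ≡ 1
  noSingleBlue Vc independent closed vs (long , _ , adjacent) one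
    with SingleMarkedEdge.singleMarkedFlanked (λ e → colour (proj₁ e) (proj₂ e) ≟c blue) vs long one
  ... | a , b , c , d , ab∈ , bc∈ , cd∈ , ¬ab , bc , ¬cd = independent b c b∈Vc c∈Vc (lookup adjacent bc∈)
    where
      b∉C : b ∉ₛ C
      b∉C b∈C = blue⇒apart b c bc (inj₁ b∈C)
      c∉C : c ∉ₛ C
      c∉C c∈C = blue⇒apart b c bc (inj₂ c∈C)
      a∈C : a ∈ₛ C
      a∈C with ¬blue⇒touches a b ¬ab
      ... | inj₁ a∈C = a∈C
      ... | inj₂ b∈C = ⊥-elim (b∉C b∈C)
      d∈C : d ∈ₛ C
      d∈C with ¬blue⇒touches c d ¬cd
      ... | inj₁ c∈C = ⊥-elim (c∉C c∈C)
      ... | inj₂ d∈C = d∈C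
      b∈Vc : b ∈ₛ Vc
      b∈Vc with b ∈? Vc
      ... | yes b∈ = b∈
      ... | no b∉  = ⊥-elim (b∉C (closed a∈C (lookup adjacent ab∈) b∉))
      c∈Vc : c ∈ₛ Vc
      c∈Vc with c ∈? Vc
      ... | yes c∈ = c∈
      ... | no c∉  = ⊥-elim (c∉C (closed d∈C (Graph.sym G (lookup adjacent cd∈)) c∉))

theorem3 : {n : ℕ} (G : Graph n) → Connected G →
    ∃[ Vc ] (Independent G Vc × Separates G Vc) → HasNACColoring G
theorem3 G (_ , walks) (Vc , independent , o , r , o∉Vc , r∉Vc , separated) =
  δ , blueEdge , redEdge , noSingleBlue Vc independent closed , noSingleRed
  where
    open ClosedComponent (component G (λ x → x ∉ₛ Vc) (λ x → ¬? (x ∈? Vc)) r r∉Vc)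
    open Incidence G C

    o∉C : o ∉ₛ C
    o∉C o∈C = separated (walkToRoot o∈C)

    o≢r : ¬ o ≡ r
    o≢r refl = separated (here o∉Vc)

    redEdge : ∃[ u ] ∃[ v ] (Adj G u v × col δ u v ≡ red)
    redEdge with neighbour (walks r o) (λ r≡o → o≢r (≡-sym r≡o))
    ... | w , rw = r , w , rw , touches⇒red r w (inj₁ root)

    -- a neighbour w of o lies outside C, as otherwise closure would put o in C
    blueEdge : ∃[ u ] ∃[ v ] (Adj G u v × col δ u v ≡ blue)
    blueEdge with neighbour (walks o r) o≢r
    ... | w , ow = o , w , ow , apart⇒blue o w λ where
      (inj₁ o∈C) → o∉C o∈C
      (inj₂ w∈C) → o∉C (closed w∈C (Graph.sym G ow) o∉Vc)
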